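{- Let $n>p$ be positive integers and let $\mathbf d=(2,\dots,2,1,\dots,1)\in\mathbb Z^n$ with $n-p$ entries equal to $2$ (indexed by the part of size $n-p$) followed by $p$ entries equal to $1$ (indexed by the singleton parts). Then the Smith normal form of $D_X(K_{n-p,1,\dots,1})|_{X=\mathbf d}$ is $\operatorname{diag}(1,1,0,\dots,0)$, and the complete multipartite graph $K_{n-p,1,\dots,1}$ on $n$ vertices (one part of size $n-p$ and $p$ parts of size $1$) belongs to $\Lambda_2^{\mathbb Z}$.
   Context: All graphs are finite, simple, connected. For a connected graph $G$ with vertex set $V$, let $X=\{x_u:u\in V\}$ be indeterminates, $D(G)$ the distance matrix (entries $d_G(u,v)$), and $D_X(G)=\operatorname{diag}(X)+D(G)$; $D_X(G)|_{X=\mathbf d}$ is the integer matrix obtained by substituting $x_u=d_u$. The Smith normal form of an integer matrix of rank $r$ is the unique diagonal matrix $\operatorname{diag}(f_1,\dots,f_r,0,\dots,0)$ equivalent to it over $\mathbb Z$ with $f_i>0$, $f_i\mid f_{i+1}$. For a commutative ring $\mathfrak R$ with unity, the $i$-th distance ideal $I_i^{\mathfrak R}(G)$ is the ideal of $\mathfrak R[X]$ generated by all $i\times i$ minors of $D_X(G)$; an ideal is trivial if it equals $\mathfrak R[X]$; $\Lambda_k^{\mathfrak R}$ is the family of connected graphs with at most $k$ trivial distance ideals over $\mathfrak R[X]$. -}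

module Defs where

open import Data.Nat as ℕ using (ℕ; zero; suc; _∸_)
open import Data.Integer as ℤ using (ℤ; +_; -[1+_])
open import Data.Integer.Divisibility using () renaming (_∣_ to _∣ℤ_)
open import Data.Fin using (Fin; zero; suc; toℕ; punchIn)
open import Data.List using (List; []; _∷_)
open import Data.Product using (Σ; ∃; _×_; _,_)
open import Data.Bool using (Bool; true; false; if_then_else_)
open import Relation.Binary.PropositionalEquality using (_≡_; _≢_)
open import Relation.Nullary using (¬_; does)

record SimpleGraph (n : ℕ) : Set₁ where
  field
    Adj     : Fin n → Fin n → Set
    symm    : ∀ {u v} → Adj u v → Adj v u
    irrefl  : ∀ {u} → ¬ Adj u u

open SimpleGraph public

data Walk {n : ℕ} (G : SimpleGraph n) : Fin n → Fin n → ℕ → Set where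
  here : ∀ {u} → Walk G u u 0
  step : ∀ {u v w k} → Adj G u v → Walk G v w k → Walk G u w (suc k)

Connected : ∀ {n} → SimpleGraph n → Set
Connected {n} G = (u v : Fin n) → ∃ λ k → Walk G u v k

IsDistanceFn : ∀ {n} → SimpleGraph n → (Fin n → Fin n → ℕ) → Set
IsDistanceFn {n} G d = (u v : Fin n) →
  Walk G u v (d u v) × (∀ k → Walk G u v k → d u v ℕ.≤ k)

completeMultipartite : ∀ {n} → (Fin n → ℕ) → SimpleGraph n
completeMultipartite part = record
  { Adj = λ u v → part u ≢ part v
  ; symm = λ ne eq → ne (Relation.Binary.PropositionalEquality.sym eq)
  ; irrefl = λ ne → ne Relation.Binary.PropositionalEquality.refl
  }

-- K_{n-p,1,...,1}: vertices with toℕ u < n - p form the big part (label 0),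
-- every other vertex u is its own singleton part (label toℕ u ≥ n - p ≥ 1)
inBig : (n p : ℕ) → Fin n → Bool
inBig n p u = does (toℕ u ℕ.<? (n ∸ p))

partLabel : (n p : ℕ) → Fin n → ℕ
partLabel n p u = if inBig n p u then 0 else toℕ u

Kbig : (n p : ℕ) → SimpleGraph n
Kbig n p = completeMultipartite (partLabel n p)

dVec : (n p : ℕ) → Fin n → ℤ
dVec n p u = if inBig n p u then + 2 else + 1

-- The polynomial ring ℤ[X], X = {x_u : u ∈ Fin n}, as the free
-- commutative ℤ-algebra on the variables (syntax modulo the
-- congruence generated by the commutative-ring / ℤ-algebra laws).

infixl 6 _⊕_
infixl 7 _⊗_

data Poly (n : ℕ) : Set where
  var : Fin n → Poly n
  con : ℤ → Poly n
  _⊕_ : Poly n → Poly n → Poly n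
  _⊗_ : Poly n → Poly n → Poly n
  ⊝_  : Poly n → Poly n

infix 4 _≈_

data _≈_ {n : ℕ} : Poly n → Poly n → Set where
  ≈-refl  : ∀ {a} → a ≈ a
  ≈-sym   : ∀ {a b} → a ≈ b → b ≈ a
  ≈-trans : ∀ {a b c} → a ≈ b → b ≈ c → a ≈ c
  ⊕-cong  : ∀ {a b c d} → a ≈ b → c ≈ d → a ⊕ c ≈ b ⊕ d
  ⊗-cong  : ∀ {a b c d} → a ≈ b → c ≈ d → a ⊗ c ≈ b ⊗ d
  ⊝-cong  : ∀ {a b} → a ≈ b → ⊝ a ≈ ⊝ b
  ⊕-assoc : ∀ a b c → (a ⊕ b) ⊕ c ≈ a ⊕ (b ⊕ c)
  ⊕-comm  : ∀ a b → a ⊕ b ≈ b ⊕ a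
  ⊕-idˡ   : ∀ a → con (+ 0) ⊕ a ≈ a
  ⊝-invˡ  : ∀ a → (⊝ a) ⊕ a ≈ con (+ 0)
  ⊗-assoc : ∀ a b c → (a ⊗ b) ⊗ c ≈ a ⊗ (b ⊗ c)
  ⊗-comm  : ∀ a b → a ⊗ b ≈ b ⊗ a
  ⊗-idˡ   : ∀ a → con (+ 1) ⊗ a ≈ a
  distribˡ : ∀ a b c → a ⊗ (b ⊕ c) ≈ (a ⊗ b) ⊕ (a ⊗ c)
  con-+   : ∀ i j → con i ⊕ con j ≈ con (i ℤ.+ j)
  con-*   : ∀ i j → con i ⊗ con j ≈ con (i ℤ.* j)

eval : ∀ {n} → (Fin n → ℤ) → Poly n → ℤ
eval ρ (var u) = ρ u
eval ρ (con i) = i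
eval ρ (a ⊕ b) = eval ρ a ℤ.+ eval ρ b
eval ρ (a ⊗ b) = eval ρ a ℤ.* eval ρ b
eval ρ (⊝ a)   = ℤ.- eval ρ a

sumP : ∀ {n m} → (Fin m → Poly n) → Poly n
sumP {m = zero}  f = con (+ 0)
sumP {m = suc m} f = f zero ⊕ sumP (λ j → f (suc j))

sign : ∀ {m} → Fin m → ℤ
sign zero = + 1
sign (suc j) = ℤ.- sign j

det : ∀ {n m} → (Fin m → Fin m → Poly n) → Poly n
det {m = zero}  M = con (+ 1)
det {m = suc m} M =
  sumP (λ j → con (sign j) ⊗ M zero j ⊗ det (λ a b → M (suc a) (punchIn j b)))

DX : ∀ {n} → (Fin n → Fin n → ℕ) → Fin n → Fin n → Poly n
DX d u v = (if does (u Data.Fin.≟ v) then var u else con (+ 0)) ⊕ con (+ d u v)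

StrictlyIncreasing : ∀ {i n} → (Fin i → Fin n) → Set
StrictlyIncreasing f = ∀ a b → a Data.Fin.< b → f a Data.Fin.< f b

record MinorIx (n i : ℕ) : Set where
  constructor minorIx
  field
    rows cols : Fin i → Fin n
    rows-inc  : StrictlyIncreasing rows
    cols-inc  : StrictlyIncreasing cols

minor : ∀ {n i} → (Fin n → Fin n → Poly n) → MinorIx n i → Poly n
minor M (minorIx r c _ _) = det (λ a b → M (r a) (c b))

sumL : ∀ {n} → List (Poly n) → Poly n
sumL []       = con (+ 0)
sumL (x ∷ xs) = x ⊕ sumL xs

combo : ∀ {n i} → (Fin n → Fin n → Poly n) → List (Poly n × MinorIx n i) → List (Poly n)
combo M [] = []
combo M ((a , g) ∷ xs) = (a ⊗ minor M g) ∷ combo M xs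

-- the ideal generated by the i × i minors of M is all of ℤ[X]
-- (i.e. contains 1)
TrivialIdeal : ∀ {n} → (Fin n → Fin n → Poly n) → ℕ → Set
TrivialIdeal {n} M i = Σ (List (Poly n × MinorIx n i)) λ gs → sumL (combo M gs) ≈ con (+ 1)

-- G (with distance function d) has at most k trivial distance ideals
-- among I_1, ..., I_n, and is connected: G ∈ Λ_k^ℤ
InΛ : ∀ {n} → ℕ → (G : SimpleGraph n) → (Fin n → Fin n → ℕ) → Set
InΛ {n} k G d = Connected G ×
  ((f : Fin (suc k) → ℕ) → (∀ a b → f a ≡ f b → a ≡ b) →
   (∀ a → 1 ℕ.≤ f a × f a ℕ.≤ n) → ¬ (∀ a → TrivialIdeal (DX d) (f a)))

Mat : ℕ → Set
Mat n = Fin n → Fin n → ℤ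

sumℤ : ∀ {m} → (Fin m → ℤ) → ℤ
sumℤ {zero}  f = + 0
sumℤ {suc m} f = f zero ℤ.+ sumℤ (λ j → f (suc j))

_·_ : ∀ {n} → Mat n → Mat n → Mat n
(A · B) i j = sumℤ (λ k → A i k ℤ.* B k j)

idMat : ∀ {n} → Mat n
idMat i j = if does (i Data.Fin.≟ j) then + 1 else + 0

_≐_ : ∀ {n} → Mat n → Mat n → Set
A ≐ B = ∀ i j → A i j ≡ B i j

Unimodular : ∀ {n} → Mat n → Set
Unimodular {n} P = Σ (Mat n) λ P' → (P · P') ≐ idMat × (P' · P) ≐ idMat

SNFShape : ∀ {n} → Mat n → Set
SNFShape {n} S = Σ ℕ λ r → r ℕ.≤ n ×
  (∀ i j → i ≢ j → S i j ≡ + 0) ×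
  (∀ i → toℕ i ℕ.< r → ℤ.+ 0 ℤ.< S i i) ×
  (∀ i → r ℕ.≤ toℕ i → S i i ≡ + 0) ×
  (∀ i j → toℕ i ℕ.< toℕ j → toℕ j ℕ.< r → S i i ∣ℤ S j j)

IsSmithNormalForm : ∀ {n} → Mat n → Mat n → Set
IsSmithNormalForm {n} M S = SNFShape S ×
  Σ (Mat n) λ P → Σ (Mat n) λ Q → Unimodular P × Unimodular Q × ((P · M) · Q) ≐ S

diag110 : ∀ {n} → Mat n
diag110 i j = if does (i Data.Fin.≟ j) ∧ does (toℕ i ℕ.<? 2) then + 1 else + 0
  where open Data.Bool using (_∧_)

-- Let β be the indicator vector of the part of size n − p.  Two distinct vertices are at
-- distance 2 if both lie in that part (the last vertex, a singleton part, is a common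
-- neighbour) and at distance 1 otherwise, so substituting X = d turns D_X into
-- M = β βᵀ + 𝟙 𝟙ᵀ, a matrix of rank at most 2.  Its minors of size ≥ 3 vanish, so evaluation
-- at d maps every distance ideal I_i with i ≥ 3 to 0: none of them is trivial.  Since
-- β₀ = 1 and β vanishes at the last vertex, a transposition and two transvections give a
-- unimodular P with P β = e₀ and P 𝟙 = e₁, whence P M Pᵀ = e₀ e₀ᵀ + e₁ e₁ᵀ = diag(1,1,0,…,0).

module Submission where

open import Defs
open import Data.Nat as ℕ using (ℕ; zero; suc; _≤_; _<_; _∸_; s≤s; z≤n)
import Data.Nat.Properties as ℕ
open import Data.Integer as ℤ using (ℤ; +_; -1ℤ; _+_; _*_; -_; _-_)
import Data.Integer.Properties as ℤ
open import Data.Integer.Tactic.RingSolver using (solve-∀)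
open import Data.Fin as Fin using (Fin; zero; suc; toℕ; punchIn; fromℕ)
open import Data.Fin.Patterns using (0F; 1F; 2F)
import Data.Fin.Properties as Fin
open import Data.Fin.Permutation as Perm using (Permutation′; _⟨$⟩ʳ_)
open import Data.Vec.Functional using (Vector)
open import Algebra.Properties.Semiring.Sum ℤ.+-*-semiring
  using (sum; sum-cong-≗; ∑-comm; ∑-distrib-+; *-distribˡ-sum; *-distribʳ-sum; sum-replicate-zero)
open import Data.Product using (Σ-syntax; ∃; _×_; _,_; proj₁; proj₂)
open import Data.Bool using (true; false; if_then_else_; _∧_)
open import Data.Bool.Properties using (∧-zeroʳ)
import Data.Nat.Divisibility as ℕ
open import Data.Integer.Divisibility using () renaming (_∣_ to _ℤ∣_)
open import Data.Empty using (⊥-elim)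
open import Function using (_∘_)
open import Relation.Nullary using (¬_; Dec; yes; no; does)
open import Relation.Nullary.Decidable using (dec-true; dec-false)
open import Relation.Binary.PropositionalEquality
open ≡-Reasoning
open import Data.List using ([]; _∷_)

sumℤ≡sum : ∀ {m} (f : Fin m → ℤ) → sumℤ f ≡ sum f
sumℤ≡sum {zero}  f = refl
sumℤ≡sum {suc m} f = cong (_+_ (f zero)) (sumℤ≡sum (f ∘ suc))

_∙_ : ∀ {n} → Vector ℤ n → Vector ℤ n → ℤ
x ∙ y = sum (λ k → x k * y k)

infix 8 _∙_

∙-comm : ∀ {n} (x y : Vector ℤ n) → x ∙ y ≡ y ∙ x
∙-comm x y = sum-cong-≗ (λ k → ℤ.*-comm (x k) (y k))

∙-congʳ : ∀ {n} (w : Vector ℤ n) {x y : Vector ℤ n} → x ≗ y → w ∙ x ≡ w ∙ y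
∙-congʳ w x≗y = sum-cong-≗ (λ k → cong (w k *_) (x≗y k))

∙-distrib-+ : ∀ {n} (w x y : Vector ℤ n) → w ∙ (λ k → x k + y k) ≡ w ∙ x + w ∙ y
∙-distrib-+ w x y =
  trans (sum-cong-≗ (λ k → ℤ.*-distribˡ-+ (w k) (x k) (y k))) (∑-distrib-+ (λ k → w k * x k) (λ k → w k * y k))

∙-*ʳ : ∀ {n} (w x : Vector ℤ n) (a : ℤ) → w ∙ (λ k → x k * a) ≡ w ∙ x * a
∙-*ʳ w x a = trans (sum-cong-≗ (λ k → sym (ℤ.*-assoc (w k) (x k) a))) (sym (*-distribʳ-sum a (λ k → w k * x k)))

∙-linear : ∀ {n} (w x y : Vector ℤ n) (a b : ℤ) →
           w ∙ (λ k → x k * a + y k * b) ≡ w ∙ x * a + w ∙ y * b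
∙-linear w x y a b = trans (∙-distrib-+ w _ _) (cong₂ _+_ (∙-*ʳ w x a) (∙-*ʳ w y b))

∙-unitˡ : ∀ {n} (i : Fin n) (x : Vector ℤ n) → idMat i ∙ x ≡ x i
∙-unitˡ {suc n} zero x = begin
  + 1 * x zero + sum (λ k → + 0 * x (suc k))  ≡⟨ cong₂ _+_ (ℤ.*-identityˡ (x zero)) (sum-replicate-zero n) ⟩
  x zero + + 0                                ≡⟨ ℤ.+-identityʳ (x zero) ⟩
  x zero                                      ∎
∙-unitˡ {suc n} (suc i) x = trans (ℤ.+-identityˡ _) (∙-unitˡ i (x ∘ suc))

∙-unitʳ : ∀ {n} (x : Vector ℤ n) (j : Fin n) → x ∙ idMat j ≡ x j
∙-unitʳ x j = trans (∙-comm x (idMat j)) (∙-unitˡ j x)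

idMat-sym : ∀ {n} (i j : Fin n) → idMat i j ≡ idMat j i
idMat-sym zero    zero    = refl
idMat-sym zero    (suc j) = refl
idMat-sym (suc i) zero    = refl
idMat-sym (suc i) (suc j) = idMat-sym i j

_·ᵥ_ : ∀ {n} → Mat n → Vector ℤ n → Vector ℤ n
(A ·ᵥ x) i = A i ∙ x

infixr 5 _·ᵥ_

_ᵀ : ∀ {n} → Mat n → Mat n
(A ᵀ) i j = A j i

infix 30 _ᵀ

·-entry : ∀ {n} (A B : Mat n) (i j : Fin n) → (A · B) i j ≡ A i ∙ (λ k → B k j)
·-entry A B i j = sumℤ≡sum (λ k → A i k * B k j)

·-congˡ : ∀ {n} {A A′ : Mat n} (B : Mat n) → A ≐ A′ → (A · B) ≐ (A′ · B)
·-congˡ {A = A} {A′} B A≐A′ i j = begin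
  (A · B) i j               ≡⟨ ·-entry A B i j ⟩
  A i ∙ (λ k → B k j)       ≡⟨ sum-cong-≗ (λ k → cong (_* B k j) (A≐A′ i k)) ⟩
  A′ i ∙ (λ k → B k j)      ≡⟨ ·-entry A′ B i j ⟨
  (A′ · B) i j              ∎

·-congʳ : ∀ {n} (A : Mat n) {B B′ : Mat n} → B ≐ B′ → (A · B) ≐ (A · B′)
·-congʳ A {B} {B′} B≐B′ i j = begin
  (A · B) i j               ≡⟨ ·-entry A B i j ⟩
  A i ∙ (λ k → B k j)       ≡⟨ ∙-congʳ (A i) (λ k → B≐B′ k j) ⟩
  A i ∙ (λ k → B′ k j)      ≡⟨ ·-entry A B′ i j ⟨
  (A · B′) i j              ∎

·ᵥ-cong : ∀ {n} (A : Mat n) {x y : Vector ℤ n} → x ≗ y → A ·ᵥ x ≗ A ·ᵥ y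
·ᵥ-cong A x≗y i = ∙-congʳ (A i) x≗y

·ᵥ-identityˡ : ∀ {n} (x : Vector ℤ n) → idMat ·ᵥ x ≗ x
·ᵥ-identityˡ x i = ∙-unitˡ i x

·ᵥ-assoc : ∀ {n} (A B : Mat n) (x : Vector ℤ n) → (A · B) ·ᵥ x ≗ A ·ᵥ B ·ᵥ x
·ᵥ-assoc A B x i = begin
  sum (λ k → (A · B) i k * x k)                  ≡⟨ sum-cong-≗ (λ k → cong (_* x k) (·-entry A B i k)) ⟩
  sum (λ k → sum (λ l → A i l * B l k) * x k)    ≡⟨ sum-cong-≗ (λ k → *-distribʳ-sum (x k) (λ l → A i l * B l k)) ⟩
  sum (λ k → sum (λ l → A i l * B l k * x k))    ≡⟨ ∑-comm (λ k l → A i l * B l k * x k) ⟩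
  sum (λ l → sum (λ k → A i l * B l k * x k))    ≡⟨ sum-cong-≗ (λ l → sum-cong-≗ (λ k → ℤ.*-assoc (A i l) (B l k) (x k))) ⟩
  sum (λ l → sum (λ k → A i l * (B l k * x k)))  ≡⟨ sum-cong-≗ (λ l → *-distribˡ-sum (A i l) (λ k → B l k * x k)) ⟨
  (A ·ᵥ B ·ᵥ x) i                                ∎

·-transpose : ∀ {n} (A B : Mat n) → (A · B) ᵀ ≐ (B ᵀ · A ᵀ)
·-transpose A B i j =
  trans (·-entry A B j i) (trans (∙-comm (A j) (λ k → B k i)) (sym (·-entry (B ᵀ) (A ᵀ) i j)))

·≐idMat-by-action : ∀ {n} (A B : Mat n) → (∀ x → A ·ᵥ B ·ᵥ x ≗ x) → (A · B) ≐ idMat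
·≐idMat-by-action A B AB≗id i j = begin
  (A · B) i j                 ≡⟨ ·-entry A B i j ⟩
  A i ∙ (λ k → B k j)         ≡⟨ ∙-congʳ (A i) (λ k → ∙-unitʳ (B k) j) ⟨
  (A ·ᵥ B ·ᵥ idMat j) i       ≡⟨ AB≗id (idMat j) i ⟩
  idMat j i                   ≡⟨ idMat-sym j i ⟩
  idMat i j                   ∎

·ᵥ-inverse : ∀ {n} (A B : Mat n) → (A · B) ≐ idMat → ∀ x → A ·ᵥ B ·ᵥ x ≗ x
·ᵥ-inverse A B AB≐id x i = begin
  (A ·ᵥ B ·ᵥ x) i       ≡⟨ ·ᵥ-assoc A B x i ⟨
  ((A · B) ·ᵥ x) i      ≡⟨ sum-cong-≗ (λ k → cong (_* x k) (AB≐id i k)) ⟩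
  (idMat ·ᵥ x) i        ≡⟨ ·ᵥ-identityˡ x i ⟩
  x i                   ∎

unimodular-by-action : ∀ {n} {A : Mat n} (B : Mat n) →
  (∀ x → A ·ᵥ B ·ᵥ x ≗ x) → (∀ x → B ·ᵥ A ·ᵥ x ≗ x) → Unimodular A
unimodular-by-action {A = A} B AB≗id BA≗id = B , ·≐idMat-by-action A B AB≗id , ·≐idMat-by-action B A BA≗id

·ᵥ-inverse-· : ∀ {n} {A A′ B B′ : Mat n} → (∀ x → A ·ᵥ A′ ·ᵥ x ≗ x) → (∀ x → B ·ᵥ B′ ·ᵥ x ≗ x) →
  ∀ x → (A · B) ·ᵥ (B′ · A′) ·ᵥ x ≗ x
·ᵥ-inverse-· {A = A} {A′} {B} {B′} AA′≗id BB′≗id x i = begin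
  ((A · B) ·ᵥ (B′ · A′) ·ᵥ x) i     ≡⟨ ·ᵥ-assoc A B _ i ⟩
  (A ·ᵥ B ·ᵥ (B′ · A′) ·ᵥ x) i      ≡⟨ ·ᵥ-cong A (·ᵥ-cong B (·ᵥ-assoc B′ A′ x)) i ⟩
  (A ·ᵥ B ·ᵥ B′ ·ᵥ A′ ·ᵥ x) i       ≡⟨ ·ᵥ-cong A (BB′≗id (A′ ·ᵥ x)) i ⟩
  (A ·ᵥ A′ ·ᵥ x) i                  ≡⟨ AA′≗id x i ⟩
  x i                               ∎

unimodular-· : ∀ {n} (A B : Mat n) → Unimodular A → Unimodular B → Unimodular (A · B)
unimodular-· A B (A′ , AA′≐id , A′A≐id) (B′ , BB′≐id , B′B≐id) = unimodular-by-action (B′ · A′)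
  (·ᵥ-inverse-· {A = A} {A′} {B} {B′} (·ᵥ-inverse A A′ AA′≐id) (·ᵥ-inverse B B′ BB′≐id))
  (·ᵥ-inverse-· {A = B′} {B} {A′} {A} (·ᵥ-inverse B′ B B′B≐id) (·ᵥ-inverse A′ A A′A≐id))

unimodular-ᵀ : ∀ {n} (A : Mat n) → Unimodular A → Unimodular (A ᵀ)
unimodular-ᵀ A (A′ , AA′≐id , A′A≐id) = A′ ᵀ , transposed A′ A A′A≐id , transposed A A′ AA′≐id
  where
  transposed : ∀ B C → (B · C) ≐ idMat → (C ᵀ · B ᵀ) ≐ idMat
  transposed B C BC≐id i j = trans (sym (·-transpose B C i j)) (trans (BC≐id j i) (idMat-sym j i))

_⊠_ : ∀ {n} → Vector ℤ n → Vector ℤ n → Mat n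
(x ⊠ y) i j = x i * y j

_⊞_ : ∀ {n} → Mat n → Mat n → Mat n
(A ⊞ B) i j = A i j + B i j

infixl 22 _⊠_
infixl 21 _⊞_

·-⊠⊞⊠ : ∀ {n} (A : Mat n) (x a y b : Vector ℤ n) → (A · (x ⊠ a ⊞ y ⊠ b)) ≐ (A ·ᵥ x) ⊠ a ⊞ (A ·ᵥ y) ⊠ b
·-⊠⊞⊠ A x a y b i j = trans (·-entry A (x ⊠ a ⊞ y ⊠ b) i j) (∙-linear (A i) x y (a j) (b j))

⊠⊞⊠-·ᵀ : ∀ {n} (x a y b : Vector ℤ n) (A : Mat n) →
  ((x ⊠ a ⊞ y ⊠ b) · A ᵀ) ≐ x ⊠ (A ·ᵥ a) ⊞ y ⊠ (A ·ᵥ b)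
⊠⊞⊠-·ᵀ x a y b A i j = begin
  ((x ⊠ a ⊞ y ⊠ b) · A ᵀ) i j               ≡⟨ ·-entry (x ⊠ a ⊞ y ⊠ b) (A ᵀ) i j ⟩
  (x ⊠ a ⊞ y ⊠ b) i ∙ A j                   ≡⟨ ∙-comm _ (A j) ⟩
  A j ∙ (λ k → x i * a k + y i * b k)       ≡⟨ ∙-congʳ (A j) (λ k → cong₂ _+_ (ℤ.*-comm (x i) (a k)) (ℤ.*-comm (y i) (b k))) ⟩
  A j ∙ (λ k → a k * x i + b k * y i)       ≡⟨ ∙-linear (A j) a b (x i) (y i) ⟩
  (A ·ᵥ a) j * x i + (A ·ᵥ b) j * y i       ≡⟨ cong₂ _+_ (ℤ.*-comm ((A ·ᵥ a) j) (x i)) (ℤ.*-comm ((A ·ᵥ b) j) (y i)) ⟩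
  (x ⊠ (A ·ᵥ a) ⊞ y ⊠ (A ·ᵥ b)) i j         ∎

congruence-⊠⊞⊠ : ∀ {n} (P M : Mat n) (x y : Vector ℤ n) → M ≐ x ⊠ x ⊞ y ⊠ y →
  ((P · M) · P ᵀ) ≐ (P ·ᵥ x) ⊠ (P ·ᵥ x) ⊞ (P ·ᵥ y) ⊠ (P ·ᵥ y)
congruence-⊠⊞⊠ P M x y M≐ i j = begin
  ((P · M) · P ᵀ) i j                                ≡⟨ ·-congˡ (P ᵀ) (·-congʳ P M≐) i j ⟩
  ((P · (x ⊠ x ⊞ y ⊠ y)) · P ᵀ) i j                  ≡⟨ ·-congˡ (P ᵀ) (·-⊠⊞⊠ P x x y y) i j ⟩
  (((P ·ᵥ x) ⊠ x ⊞ (P ·ᵥ y) ⊠ y) · P ᵀ) i j          ≡⟨ ⊠⊞⊠-·ᵀ (P ·ᵥ x) x (P ·ᵥ y) y P i j ⟩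
  ((P ·ᵥ x) ⊠ (P ·ᵥ x) ⊞ (P ·ᵥ y) ⊠ (P ·ᵥ y)) i j    ∎

transvection : ∀ {n} → Vector ℤ n → Vector ℤ n → Mat n
transvection u w = idMat ⊞ u ⊠ w

transvection-·ᵥ : ∀ {n} (u w x : Vector ℤ n) → transvection u w ·ᵥ x ≗ λ i → x i + u i * w ∙ x
transvection-·ᵥ u w x i = begin
  sum (λ k → (idMat i k + u i * w k) * x k)             ≡⟨ sum-cong-≗ (λ k → ℤ.*-distribʳ-+ (x k) (idMat i k) _) ⟩
  sum (λ k → idMat i k * x k + u i * w k * x k)         ≡⟨ ∑-distrib-+ (λ k → idMat i k * x k) (λ k → u i * w k * x k) ⟩
  idMat i ∙ x + sum (λ k → u i * w k * x k)             ≡⟨ cong₂ _+_ (∙-unitˡ i x) (sum-cong-≗ (λ k → ℤ.*-assoc (u i) (w k) (x k))) ⟩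
  x i + sum (λ k → u i * (w k * x k))                   ≡⟨ cong (_+_ (x i)) (*-distribˡ-sum (u i) (λ k → w k * x k)) ⟨
  x i + u i * w ∙ x                                     ∎

transvection-cancel : ∀ {n} (u u′ w : Vector ℤ n) → (∀ k → u′ k ≡ - u k) → w ∙ u′ ≡ + 0 →
  ∀ x → transvection u w ·ᵥ transvection u′ w ·ᵥ x ≗ x
transvection-cancel u u′ w u′≡-u w∙u′≡0 x i = begin
  (transvection u w ·ᵥ y) i                ≡⟨ transvection-·ᵥ u w y i ⟩
  y i + u i * w ∙ y                        ≡⟨ cong₂ (λ s t → s + u i * t) (transvection-·ᵥ u′ w x i) w∙y≡w∙x ⟩
  x i + u′ i * w ∙ x + u i * w ∙ x         ≡⟨ cong (λ s → x i + s * w ∙ x + u i * w ∙ x) (u′≡-u i) ⟩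
  x i + - u i * w ∙ x + u i * w ∙ x        ≡⟨ cancel (x i) (u i) (w ∙ x) ⟩
  x i                                      ∎
  where
  y : Vector ℤ _
  y = transvection u′ w ·ᵥ x
  cancel : ∀ a b c → a + - b * c + b * c ≡ a
  cancel = solve-∀
  w∙y≡w∙x : w ∙ y ≡ w ∙ x
  w∙y≡w∙x = begin
    w ∙ y                                  ≡⟨ ∙-congʳ w (transvection-·ᵥ u′ w x) ⟩
    w ∙ (λ k → x k + u′ k * w ∙ x)         ≡⟨ ∙-distrib-+ w x (λ k → u′ k * w ∙ x) ⟩
    w ∙ x + w ∙ (λ k → u′ k * w ∙ x)       ≡⟨ cong (_+_ (w ∙ x)) (trans (∙-*ʳ w u′ (w ∙ x)) (cong (_* w ∙ x) w∙u′≡0)) ⟩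
    w ∙ x + + 0                            ≡⟨ ℤ.+-identityʳ (w ∙ x) ⟩
    w ∙ x                                  ∎

transvection-unimodular : ∀ {n} (u w : Vector ℤ n) → w ∙ u ≡ + 0 → Unimodular (transvection u w)
transvection-unimodular u w w∙u≡0 = unimodular-by-action (transvection -u w)
  (transvection-cancel u -u w (λ _ → refl) w∙-u≡0)
  (transvection-cancel -u u w (λ k → sym (ℤ.neg-involutive (u k))) w∙u≡0)
  where
  -u : Vector ℤ _
  -u k = - u k
  w∙-u≡0 : w ∙ -u ≡ + 0
  w∙-u≡0 = begin
    w ∙ -u                      ≡⟨ ∙-congʳ w (λ k → trans (sym (ℤ.-1*i≡-i (u k))) (ℤ.*-comm -1ℤ (u k))) ⟩
    w ∙ (λ k → u k * -1ℤ)       ≡⟨ ∙-*ʳ w u -1ℤ ⟩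
    w ∙ u * -1ℤ                 ≡⟨ cong (_* -1ℤ) w∙u≡0 ⟩
    + 0                         ∎

permutationMatrix : ∀ {n} → Permutation′ n → Mat n
permutationMatrix π i = idMat (π ⟨$⟩ʳ i)

permutationMatrix-·ᵥ : ∀ {n} (π : Permutation′ n) (x : Vector ℤ n) → permutationMatrix π ·ᵥ x ≗ x ∘ (π ⟨$⟩ʳ_)
permutationMatrix-·ᵥ π x i = ∙-unitˡ (π ⟨$⟩ʳ i) x

permutationMatrix-unimodular : ∀ {n} (π : Permutation′ n) → Unimodular (permutationMatrix π)
permutationMatrix-unimodular π = unimodular-by-action (permutationMatrix (Perm.flip π))
  (λ x i → trans (permutationMatrix-·ᵥ π (permutationMatrix (Perm.flip π) ·ᵥ x) i)
                 (trans (permutationMatrix-·ᵥ (Perm.flip π) x _) (cong x (Perm.inverseˡ π))))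
  (λ x i → trans (permutationMatrix-·ᵥ (Perm.flip π) (permutationMatrix π ·ᵥ x) i)
                 (trans (permutationMatrix-·ᵥ π x _) (cong x (Perm.inverseʳ π))))

𝟙 : ∀ {n} → Vector ℤ n
𝟙 _ = + 1

transvection-unit-·ᵥ : ∀ {n} (u : Vector ℤ n) (j : Fin n) (x : Vector ℤ n) →
  transvection u (idMat j) ·ᵥ x ≗ λ i → x i + u i * x j
transvection-unit-·ᵥ u j x i = trans (transvection-·ᵥ u (idMat j) x i) (cong (λ t → x i + u i * t) (∙-unitˡ j x))

basis-change₀₁ : ∀ {k} (x : Vector ℤ (suc (suc k))) → x 0F ≡ + 1 → x 1F ≡ + 0 →
  Σ[ P ∈ Mat (suc (suc k)) ] Unimodular P × P ·ᵥ x ≗ idMat 0F × P ·ᵥ 𝟙 ≗ idMat 1F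
basis-change₀₁ x x₀≡1 x₁≡0 =
    τ₂ · τ₁
  , unimodular-· τ₂ τ₁ (transvection-unimodular u₂ e₁ e₁∙u₂≡0) (transvection-unimodular u₁ e₀ e₀∙u₁≡0)
  , (λ i → trans (·ᵥ-assoc τ₂ τ₁ x i) (trans (·ᵥ-cong τ₂ τ₁x≗e₀ i) (τ₂e₀≗e₀ i)))
  , (λ i → trans (·ᵥ-assoc τ₂ τ₁ 𝟙 i) (τ₂w≗e₁ i))
  where
  e₀ e₁ u₁ w u₂ : Vector ℤ _
  τ₁ τ₂ : Mat _
  e₀ = idMat 0F
  e₁ = idMat 1F
  u₁ i = e₀ i - x i
  τ₁ = transvection u₁ e₀
  w = τ₁ ·ᵥ 𝟙
  u₂ i = e₁ i - w i
  τ₂ = transvection u₂ e₁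

  replace : ∀ a b → a + (b - a) * + 1 ≡ b
  replace = solve-∀

  e₀∙u₁≡0 : e₀ ∙ u₁ ≡ + 0
  e₀∙u₁≡0 = trans (∙-unitˡ 0F u₁) (cong (_-_ (+ 1)) x₀≡1)

  w₁≡1 : w 1F ≡ + 1
  w₁≡1 = trans (transvection-unit-·ᵥ u₁ 0F 𝟙 1F) (cong (λ t → + 1 + (+ 0 - t) * + 1) x₁≡0)

  e₁∙u₂≡0 : e₁ ∙ u₂ ≡ + 0
  e₁∙u₂≡0 = trans (∙-unitˡ 1F u₂) (cong (_-_ (+ 1)) w₁≡1)

  τ₁x≗e₀ : τ₁ ·ᵥ x ≗ e₀
  τ₁x≗e₀ i = trans (transvection-unit-·ᵥ u₁ 0F x i) (trans (cong (λ t → x i + u₁ i * t) x₀≡1) (replace (x i) (e₀ i)))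

  τ₂e₀≗e₀ : τ₂ ·ᵥ e₀ ≗ e₀
  τ₂e₀≗e₀ i = trans (transvection-unit-·ᵥ u₂ 1F e₀ i)
    (trans (cong (_+_ (e₀ i)) (ℤ.*-zeroʳ (u₂ i))) (ℤ.+-identityʳ (e₀ i)))

  τ₂w≗e₁ : τ₂ ·ᵥ w ≗ e₁
  τ₂w≗e₁ i = trans (transvection-unit-·ᵥ u₂ 1F w i) (trans (cong (λ t → w i + u₂ i * t) w₁≡1) (replace (w i) (e₁ i)))

basis-change : ∀ {k} (x : Vector ℤ (suc (suc k))) (z : Fin (suc k)) → x 0F ≡ + 1 → x (suc z) ≡ + 0 →
  Σ[ P ∈ Mat (suc (suc k)) ] Unimodular P × P ·ᵥ x ≗ idMat 0F × P ·ᵥ 𝟙 ≗ idMat 1F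
basis-change x z x₀≡1 x₁₊z≡0 =
  let P , P-unimodular , Pxπ≗e₀ , P𝟙≗e₁ = basis-change₀₁ (x ∘ (π ⟨$⟩ʳ_)) x₀≡1 x₁₊z≡0
  in  P · Π
    , unimodular-· P Π P-unimodular (permutationMatrix-unimodular π)
    , (λ i → trans (·ᵥ-assoc P Π x i) (trans (·ᵥ-cong P (permutationMatrix-·ᵥ π x) i) (Pxπ≗e₀ i)))
    , (λ i → trans (·ᵥ-assoc P Π 𝟙 i) (trans (·ᵥ-cong P (permutationMatrix-·ᵥ π 𝟙) i) (P𝟙≗e₁ i)))
  where
  π : Permutation′ _
  π = Perm.transpose 1F (suc z)
  Π : Mat _
  Π = permutationMatrix π

diag110-SNFShape : ∀ {k} → SNFShape (diag110 {suc (suc k)})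
diag110-SNFShape = 2 , s≤s (s≤s z≤n) , off-diagonal , positive , vanishing , divides
  where
  off-diagonal : ∀ i j → i ≢ j → diag110 i j ≡ + 0
  off-diagonal i j i≢j = cong (λ b → if b ∧ does (toℕ i ℕ.<? 2) then + 1 else + 0) (dec-false (i Fin.≟ j) i≢j)
  positive : ∀ i → toℕ i < 2 → + 0 ℤ.< diag110 i i
  positive 0F            _ = ℤ.+<+ (s≤s z≤n)
  positive 1F            _ = ℤ.+<+ (s≤s z≤n)
  positive (suc (suc i)) (s≤s (s≤s ()))
  vanishing : ∀ i → 2 ≤ toℕ i → diag110 i i ≡ + 0
  vanishing 0F            ()
  vanishing 1F            (s≤s ())
  vanishing (suc (suc i)) _ = cong (λ b → if b then + 1 else + 0) (∧-zeroʳ (does (i Fin.≟ i)))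
  divides : ∀ i j → toℕ i < toℕ j → toℕ j < 2 → diag110 i i ℤ∣ diag110 j j
  divides 0F      1F            _        _ = ℕ.∣-refl
  divides 0F      (suc (suc j)) _        (s≤s (s≤s ()))
  divides (suc i) 1F            (s≤s ()) _
  divides (suc i) (suc (suc j)) _        (s≤s (s≤s ()))

unit-⊠⊞⊠≐diag110 : ∀ {k} → idMat 0F ⊠ idMat 0F ⊞ idMat 1F ⊠ idMat 1F ≐ diag110 {suc (suc k)}
unit-⊠⊞⊠≐diag110 0F            0F            = refl
unit-⊠⊞⊠≐diag110 0F            (suc j)       = refl
unit-⊠⊞⊠≐diag110 1F            0F            = refl
unit-⊠⊞⊠≐diag110 1F            1F            = refl
unit-⊠⊞⊠≐diag110 1F            (suc (suc j)) = refl
unit-⊠⊞⊠≐diag110 (suc (suc i)) j             =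
  cong (λ b → if b then + 1 else + 0) (sym (∧-zeroʳ (does (suc (suc i) Fin.≟ j))))

⊠⊞𝟙⊠𝟙-SNF : ∀ {k} (M : Mat (suc (suc k))) (x : Vector ℤ (suc (suc k))) (z : Fin (suc k)) →
  x 0F ≡ + 1 → x (suc z) ≡ + 0 → M ≐ x ⊠ x ⊞ 𝟙 ⊠ 𝟙 → IsSmithNormalForm M diag110
⊠⊞𝟙⊠𝟙-SNF M x z x₀≡1 x₁₊z≡0 M≐ =
  let P , P-unimodular , Px≗e₀ , P𝟙≗e₁ = basis-change x z x₀≡1 x₁₊z≡0
  in  diag110-SNFShape , P , P ᵀ , P-unimodular , unimodular-ᵀ P P-unimodular , λ i j → begin
    ((P · M) · P ᵀ) i j                                    ≡⟨ congruence-⊠⊞⊠ P M x 𝟙 M≐ i j ⟩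
    (P ·ᵥ x) i * (P ·ᵥ x) j + (P ·ᵥ 𝟙) i * (P ·ᵥ 𝟙) j
      ≡⟨ cong₂ _+_ (cong₂ _*_ (Px≗e₀ i) (Px≗e₀ j)) (cong₂ _*_ (P𝟙≗e₁ i) (P𝟙≗e₁ j)) ⟩
    (idMat 0F ⊠ idMat 0F ⊞ idMat 1F ⊠ idMat 1F) i j        ≡⟨ unit-⊠⊞⊠≐diag110 i j ⟩
    diag110 i j                                            ∎

detℤ : ∀ {m} → Mat m → ℤ
detℤ {zero}  M = + 1
detℤ {suc m} M = sum (λ j → sign j * M zero j * detℤ (λ a b → M (suc a) (punchIn j b)))

detℤ-cong : ∀ {m} {M N : Mat m} → M ≐ N → detℤ M ≡ detℤ N
detℤ-cong {zero}  M≐N = refl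
detℤ-cong {suc m} M≐N = sum-cong-≗ (λ j →
  cong₂ _*_ (cong (sign j *_) (M≐N zero j)) (detℤ-cong (λ a b → M≐N (suc a) (punchIn j b))))

-- The left-hand sides of the expansions below are detℤ unfolded.
detℤ₂ : (M : Mat 2) → detℤ M ≡ M 0F 0F * M 1F 1F - M 0F 1F * M 1F 0F
detℤ₂ M = expansion (M 0F 0F) (M 0F 1F) (M 1F 0F) (M 1F 1F)
  where
  expansion : ∀ a b c d → + 1 * a * (+ 1 * d * + 1 + + 0) + (-1ℤ * b * (+ 1 * c * + 1 + + 0) + + 0) ≡ a * d - b * c
  expansion = solve-∀

detℤ₃ : (M : Mat 3) → detℤ M ≡ M 0F 0F * (M 1F 1F * M 2F 2F - M 1F 2F * M 2F 1F)
                              - M 0F 1F * (M 1F 0F * M 2F 2F - M 1F 2F * M 2F 0F)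
                              + M 0F 2F * (M 1F 0F * M 2F 1F - M 1F 1F * M 2F 0F)
detℤ₃ M = begin
  detℤ M                                                                   ≡⟨ expansion (M 0F 0F) (M 0F 1F) (M 0F 2F) _ _ _ ⟩
  M 0F 0F * detℤ (drop 0F) - M 0F 1F * detℤ (drop 1F) + M 0F 2F * detℤ (drop 2F)
    ≡⟨ cong₂ _+_ (cong₂ _-_ (cong (M 0F 0F *_) (detℤ₂ (drop 0F))) (cong (M 0F 1F *_) (detℤ₂ (drop 1F))))
                 (cong (M 0F 2F *_) (detℤ₂ (drop 2F))) ⟩
  _                                                                        ∎
  where
  drop : Fin 3 → Mat 2
  drop j a b = M (suc a) (punchIn j b)
  expansion : ∀ a b c p q r → + 1 * a * p + (-1ℤ * b * q + (+ 1 * c * r + + 0)) ≡ a * p - b * q + c * r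
  expansion = solve-∀

detℤ-⊠⊞⊠₃ : (x a y b : Vector ℤ 3) → detℤ (x ⊠ a ⊞ y ⊠ b) ≡ + 0
detℤ-⊠⊞⊠₃ x a y b = trans (detℤ₃ (x ⊠ a ⊞ y ⊠ b))
  (cofactors (x 0F) (x 1F) (x 2F) (a 0F) (a 1F) (a 2F) (y 0F) (y 1F) (y 2F) (b 0F) (b 1F) (b 2F))
  where
  cofactors : ∀ x₀ x₁ x₂ a₀ a₁ a₂ y₀ y₁ y₂ b₀ b₁ b₂ →
      (x₀ * a₀ + y₀ * b₀) * ((x₁ * a₁ + y₁ * b₁) * (x₂ * a₂ + y₂ * b₂) - (x₁ * a₂ + y₁ * b₂) * (x₂ * a₁ + y₂ * b₁))
    - (x₀ * a₁ + y₀ * b₁) * ((x₁ * a₀ + y₁ * b₀) * (x₂ * a₂ + y₂ * b₂) - (x₁ * a₂ + y₁ * b₂) * (x₂ * a₀ + y₂ * b₀))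
    + (x₀ * a₂ + y₀ * b₂) * ((x₁ * a₀ + y₁ * b₀) * (x₂ * a₁ + y₂ * b₁) - (x₁ * a₁ + y₁ * b₁) * (x₂ * a₀ + y₂ * b₀))
    ≡ + 0
  cofactors = solve-∀

detℤ-⊠⊞⊠ : ∀ k (x a y b : Vector ℤ (3 ℕ.+ k)) → detℤ (x ⊠ a ⊞ y ⊠ b) ≡ + 0
detℤ-⊠⊞⊠ zero    = detℤ-⊠⊞⊠₃
detℤ-⊠⊞⊠ (suc k) x a y b = trans
  (sum-cong-≗ (λ j → trans (cong (sign j * (x 0F * a j + y 0F * b j) *_)
                                 (detℤ-⊠⊞⊠ k (x ∘ suc) (a ∘ punchIn j) (y ∘ suc) (b ∘ punchIn j)))
                           (ℤ.*-zeroʳ (sign j * (x 0F * a j + y 0F * b j)))))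
  (sum-replicate-zero (4 ℕ.+ k))

module _ {n : ℕ} (ρ : Vector ℤ n) where

  eval-cong : ∀ {a b : Poly n} → a ≈ b → eval ρ a ≡ eval ρ b
  eval-cong ≈-refl             = refl
  eval-cong (≈-sym a≈b)        = sym (eval-cong a≈b)
  eval-cong (≈-trans a≈b b≈c)  = trans (eval-cong a≈b) (eval-cong b≈c)
  eval-cong (⊕-cong a≈b c≈d)   = cong₂ _+_ (eval-cong a≈b) (eval-cong c≈d)
  eval-cong (⊗-cong a≈b c≈d)   = cong₂ _*_ (eval-cong a≈b) (eval-cong c≈d)
  eval-cong (⊝-cong a≈b)       = cong -_ (eval-cong a≈b)
  eval-cong (⊕-assoc a b c)    = ℤ.+-assoc (eval ρ a) (eval ρ b) (eval ρ c)
  eval-cong (⊕-comm a b)       = ℤ.+-comm (eval ρ a) (eval ρ b)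
  eval-cong (⊕-idˡ a)          = ℤ.+-identityˡ (eval ρ a)
  eval-cong (⊝-invˡ a)         = ℤ.+-inverseˡ (eval ρ a)
  eval-cong (⊗-assoc a b c)    = ℤ.*-assoc (eval ρ a) (eval ρ b) (eval ρ c)
  eval-cong (⊗-comm a b)       = ℤ.*-comm (eval ρ a) (eval ρ b)
  eval-cong (⊗-idˡ a)          = ℤ.*-identityˡ (eval ρ a)
  eval-cong (distribˡ a b c)   = ℤ.*-distribˡ-+ (eval ρ a) (eval ρ b) (eval ρ c)
  eval-cong (con-+ i j)        = refl
  eval-cong (con-* i j)        = refl

  eval-sumP : ∀ {m} (f : Fin m → Poly n) → eval ρ (sumP f) ≡ sum (λ j → eval ρ (f j))
  eval-sumP {zero}  f = refl
  eval-sumP {suc m} f = cong (_+_ (eval ρ (f zero))) (eval-sumP (f ∘ suc))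

  eval-det : ∀ {m} (M : Fin m → Fin m → Poly n) → eval ρ (det M) ≡ detℤ (λ a b → eval ρ (M a b))
  eval-det {zero}  M = refl
  eval-det {suc m} M = trans (eval-sumP (λ j → con (sign j) ⊗ M zero j ⊗ det (λ a b → M (suc a) (punchIn j b))))
    (sum-cong-≗ (λ j →
    cong (sign j * eval ρ (M zero j) *_) (eval-det (λ a b → M (suc a) (punchIn j b)))))

  vanishing-minors⇒¬TrivialIdeal : ∀ {i} (M : Fin n → Fin n → Poly n) →
    (∀ g → eval ρ (minor M g) ≡ + 0) → ¬ TrivialIdeal M i
  vanishing-minors⇒¬TrivialIdeal M minors≡0 (gs , combination≈1) =
    0≢1 (trans (sym (eval-combination≡0 gs)) (eval-cong combination≈1))
    where
    0≢1 : + 0 ≢ + 1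
    0≢1 ()
    eval-combination≡0 : ∀ gs → eval ρ (sumL (combo M gs)) ≡ + 0
    eval-combination≡0 []             = refl
    eval-combination≡0 ((a , g) ∷ gs) =
      cong₂ _+_ (trans (cong (eval ρ a *_) (minors≡0 g)) (ℤ.*-zeroʳ (eval ρ a))) (eval-combination≡0 gs)

  rank2⇒higher-ideals-nontrivial : (M : Fin n → Fin n → Poly n) (x a y b : Vector ℤ n) →
    (∀ u v → eval ρ (M u v) ≡ (x ⊠ a ⊞ y ⊠ b) u v) → ∀ i → 2 < i → ¬ TrivialIdeal M i
  rank2⇒higher-ideals-nontrivial M x a y b M≐ 1 (s≤s ())
  rank2⇒higher-ideals-nontrivial M x a y b M≐ 2 (s≤s (s≤s ()))
  rank2⇒higher-ideals-nontrivial M x a y b M≐ (suc (suc (suc i))) _ =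
    vanishing-minors⇒¬TrivialIdeal M minor≡0
    where
    minor≡0 : (g : MinorIx n (3 ℕ.+ i)) → eval ρ (minor M g) ≡ + 0
    minor≡0 (minorIx r c _ _) = begin
      eval ρ (det (λ s t → M (r s) (c t)))            ≡⟨ eval-det (λ s t → M (r s) (c t)) ⟩
      detℤ (λ s t → eval ρ (M (r s) (c t)))           ≡⟨ detℤ-cong (λ s t → M≐ (r s) (c t)) ⟩
      detℤ ((x ∘ r) ⊠ (a ∘ c) ⊞ (y ∘ r) ⊠ (b ∘ c))    ≡⟨ detℤ-⊠⊞⊠ i (x ∘ r) (a ∘ c) (y ∘ r) (b ∘ c) ⟩
      + 0                                             ∎

injective⇒exceeds : ∀ k (f : Fin (suc k) → ℕ) → (∀ a b → f a ≡ f b → a ≡ b) → (∀ a → 1 ≤ f a) →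
  ∃ λ a → k < f a
injective⇒exceeds k f f-injective 1≤f with Fin.any? (λ a → k ℕ.<? f a)
... | yes exceeds = exceeds
... | no ¬exceeds =
  let i , j , i<j , gi≡gj = Fin.pigeonhole (ℕ.n<1+n k) (λ a → Fin.fromℕ< (pred<k a))
  in  ⊥-elim (Fin.<⇒≢ i<j (f-injective i j (ℕ.pred-injective ⦃ nonZero i ⦄ ⦃ nonZero j ⦄
        (trans (sym (Fin.toℕ-fromℕ< (pred<k i))) (trans (cong toℕ gi≡gj) (Fin.toℕ-fromℕ< (pred<k j)))))))
  where
  nonZero : ∀ a → ℕ.NonZero (f a)
  nonZero a = ℕ.>-nonZero (1≤f a)
  pred<k : ∀ a → ℕ.pred (f a) < k
  pred<k a = ℕ.pred-mono-< ⦃ nonZero a ⦄ (s≤s (ℕ.≮⇒≥ (¬exceeds ∘ (a ,_))))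

higher-ideals-nontrivial⇒InΛ : ∀ {n} k {G : SimpleGraph n} {d : Fin n → Fin n → ℕ} → Connected G →
  (∀ i → k < i → ¬ TrivialIdeal (DX d) i) → InΛ k G d
higher-ideals-nontrivial⇒InΛ k connected nontrivial = connected , λ f f-injective f-range all-trivial →
  let a , k<fa = injective⇒exceeds k f f-injective (proj₁ ∘ f-range) in nontrivial (f a) k<fa (all-trivial a)

module _ {n : ℕ} {G : SimpleGraph n} {d : Fin n → Fin n → ℕ} (d-distance : IsDistanceFn G d) where

  distance-refl : ∀ u → d u u ≡ 0
  distance-refl u = ℕ.n≤0⇒n≡0 (proj₂ (d-distance u u) 0 here)

  distance-adjacent : ∀ {u v} → Adj G u v → d u v ≡ 1
  distance-adjacent {u} {v} u~v with d u v | proj₁ (d-distance u v) | proj₂ (d-distance u v) 1 (step u~v here)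
  ... | 0           | here | _ = ⊥-elim (irrefl G u~v)
  ... | 1           | _    | _ = refl
  ... | suc (suc _) | _    | s≤s ()

  distance-common-neighbour : ∀ {u v w} → u ≢ v → ¬ Adj G u v → Adj G u w → Adj G w v → d u v ≡ 2
  distance-common-neighbour {u} {v} u≢v u≁v u~w w~v
    with d u v | proj₁ (d-distance u v) | proj₂ (d-distance u v) 2 (step u~w (step w~v here))
  ... | 0                 | here           | _ = ⊥-elim (u≢v refl)
  ... | 1                 | step u~v here  | _ = ⊥-elim (u≁v u~v)
  ... | 2                 | _              | _ = refl
  ... | suc (suc (suc _)) | _              | s≤s (s≤s ())

universal-vertex⇒connected : ∀ {n} {G : SimpleGraph n} (z : Fin n) → (∀ u → u ≢ z → Adj G u z) → Connected G
universal-vertex⇒connected {G = G} z u~z u v with u Fin.≟ z | v Fin.≟ z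
... | yes refl | yes refl = 0 , here
... | yes refl | no v≢z   = 1 , step (symm G (u~z v v≢z)) here
... | no u≢z   | yes refl = 1 , step (u~z u u≢z) here
... | no u≢z   | no v≢z   = 2 , step (u~z u u≢z) (step (symm G (u~z v v≢z)) here)

eval-DX-diagonal : ∀ {n} (ρ : Vector ℤ n) (d : Fin n → Fin n → ℕ) u → eval ρ (DX d u u) ≡ ρ u + + d u u
eval-DX-diagonal ρ d u =
  cong (λ b → eval ρ ((if b then var u else con (+ 0)) ⊕ con (+ d u u))) (dec-true (u Fin.≟ u) refl)

eval-DX-off-diagonal : ∀ {n} (ρ : Vector ℤ n) (d : Fin n → Fin n → ℕ) {u v} → u ≢ v →
  eval ρ (DX d u v) ≡ + 0 + + d u v
eval-DX-off-diagonal ρ d {u} {v} u≢v =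
  cong (λ b → eval ρ ((if b then var u else con (+ 0)) ⊕ con (+ d u v))) (dec-false (u Fin.≟ v) u≢v)

module Kbig-structure (n p : ℕ) where

  Big : Fin n → Set
  Big u = toℕ u < n ∸ p

  β : Vector ℤ n
  β u = if inBig n p u then + 1 else + 0

  β-big : ∀ {u} → Big u → β u ≡ + 1
  β-big {u} u-big = cong (λ b → if b then + 1 else + 0) (dec-true (toℕ u ℕ.<? n ∸ p) u-big)

  β-small : ∀ {u} → ¬ Big u → β u ≡ + 0
  β-small {u} u-small = cong (λ b → if b then + 1 else + 0) (dec-false (toℕ u ℕ.<? n ∸ p) u-small)

  label-big : ∀ {u} → Big u → partLabel n p u ≡ 0
  label-big {u} u-big = cong (λ b → if b then 0 else toℕ u) (dec-true (toℕ u ℕ.<? n ∸ p) u-big)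

  label-small : ∀ {u} → ¬ Big u → partLabel n p u ≡ toℕ u
  label-small {u} u-small = cong (λ b → if b then 0 else toℕ u) (dec-false (toℕ u ℕ.<? n ∸ p) u-small)

  small-adjacent : ∀ {u v} → ¬ Big u → u ≢ v → Adj (Kbig n p) u v
  small-adjacent {u} {v} u-small u≢v labels≡ with toℕ v ℕ.<? n ∸ p
  ... | yes v-big  = u-small (subst (_< n ∸ p) (sym toℕu≡0) (ℕ.≤-<-trans z≤n v-big))
    where
    toℕu≡0 : toℕ u ≡ 0
    toℕu≡0 = trans (sym (label-small u-small)) (trans labels≡ (label-big v-big))
  ... | no v-small = u≢v (Fin.toℕ-injective (trans (sym (label-small u-small)) (trans labels≡ (label-small v-small))))

  big-nonadjacent : ∀ {u v} → Big u → Big v → ¬ Adj (Kbig n p) u v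
  big-nonadjacent u-big v-big u~v = u~v (trans (label-big u-big) (sym (label-big v-big)))

  module _ {d : Fin n → Fin n → ℕ} (d-distance : IsDistanceFn (Kbig n p) d) (z : Fin n) (z-small : ¬ Big z) where

    adjacent-to-z : ∀ u → u ≢ z → Adj (Kbig n p) u z
    adjacent-to-z u u≢z = symm (Kbig n p) (small-adjacent z-small (≢-sym u≢z))

    distance≡β⊠β⊞𝟙⊠𝟙 : ∀ {u v} → u ≢ v → + d u v ≡ (β ⊠ β ⊞ 𝟙 ⊠ 𝟙) u v
    distance≡β⊠β⊞𝟙⊠𝟙 {u} {v} u≢v with toℕ u ℕ.<? n ∸ p | toℕ v ℕ.<? n ∸ p
    ... | yes u-big | yes v-big = begin
      + d u v                   ≡⟨ cong +_ (distance-common-neighbour d-distance u≢v (big-nonadjacent u-big v-big)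
                                     (adjacent-to-z u (big≢z u-big)) (symm (Kbig n p) (adjacent-to-z v (big≢z v-big)))) ⟩
      + 1 * + 1 + + 1 * + 1     ≡⟨ cong₂ (λ s t → s * t + + 1 * + 1) (β-big u-big) (β-big v-big) ⟨
      β u * β v + + 1 * + 1     ∎
      where
      big≢z : ∀ {w} → Big w → w ≢ z
      big≢z w-big refl = z-small w-big
    ... | no u-small | _ = begin
      + d u v                   ≡⟨ cong +_ (distance-adjacent d-distance (small-adjacent u-small u≢v)) ⟩
      + 0 * β v + + 1 * + 1     ≡⟨ cong (λ s → s * β v + + 1 * + 1) (β-small u-small) ⟨
      β u * β v + + 1 * + 1     ∎
    ... | yes _ | no v-small = begin
      + d u v                   ≡⟨ cong +_ (distance-adjacent d-distance (symm (Kbig n p) (small-adjacent v-small (≢-sym u≢v)))) ⟩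
      + 1                       ≡⟨ cong (λ s → s + + 1 * + 1) (ℤ.*-zeroʳ (β u)) ⟨
      β u * + 0 + + 1 * + 1     ≡⟨ cong (λ t → β u * t + + 1 * + 1) (β-small v-small) ⟨
      β u * β v + + 1 * + 1     ∎

    DX≡β⊠β⊞𝟙⊠𝟙 : ∀ u v → eval (dVec n p) (DX d u v) ≡ (β ⊠ β ⊞ 𝟙 ⊠ 𝟙) u v
    DX≡β⊠β⊞𝟙⊠𝟙 u v = by-cases (u Fin.≟ v)
      where
      diagonal : ∀ b → (if b then + 2 else + 1) + + 0 ≡ (if b then + 1 else + 0) * (if b then + 1 else + 0) + + 1 * + 1
      diagonal true  = refl
      diagonal false = refl
      by-cases : Dec (u ≡ v) → eval (dVec n p) (DX d u v) ≡ (β ⊠ β ⊞ 𝟙 ⊠ 𝟙) u v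
      by-cases (yes refl) = begin
        eval (dVec n p) (DX d u u)       ≡⟨ eval-DX-diagonal (dVec n p) d u ⟩
        dVec n p u + + d u u             ≡⟨ cong (λ m → dVec n p u + + m) (distance-refl d-distance u) ⟩
        dVec n p u + + 0                 ≡⟨ diagonal (inBig n p u) ⟩
        β u * β u + + 1 * + 1            ∎
      by-cases (no u≢v) =
        trans (eval-DX-off-diagonal (dVec n p) d u≢v) (trans (ℤ.+-identityˡ (+ d u v)) (distance≡β⊠β⊞𝟙⊠𝟙 u≢v))

mainTheorem10 : (n p : ℕ) → 1 ≤ p → p < n →
    (d : Fin n → Fin n → ℕ) → IsDistanceFn (Kbig n p) d →
    IsSmithNormalForm (λ u v → eval (dVec n p) (DX d u v)) diag110
      × InΛ 2 (Kbig n p) d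
mainTheorem10 zero                p       _  ()
mainTheorem10 (suc zero)          zero    () _
mainTheorem10 (suc zero)          (suc p) _  (s≤s ())
mainTheorem10 n@(suc (suc k)) p 1≤p p<n d d-distance =
    ⊠⊞𝟙⊠𝟙-SNF _ β (fromℕ k) (β-big zero-big) (β-small z-small) entries
  , higher-ideals-nontrivial⇒InΛ 2 (universal-vertex⇒connected z (adjacent-to-z d-distance z z-small))
      (rank2⇒higher-ideals-nontrivial (dVec n p) (DX d) β β 𝟙 𝟙 entries)
  where
  open Kbig-structure n p
  z : Fin n
  z = fromℕ (suc k)
  zero-big : Big zero
  zero-big = ℕ.m<n⇒0<n∸m p<n
  z-small : ¬ Big z
  z-small z-big = ℕ.<-irrefl refl (ℕ.<-≤-trans (subst (_< n ∸ p) (Fin.toℕ-fromℕ (suc k)) z-big) (ℕ.∸-monoʳ-≤ n 1≤p))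
  entries : ∀ u v → eval (dVec n p) (DX d u v) ≡ (β ⊠ β ⊞ 𝟙 ⊠ 𝟙) u v
  entries = DX≡β⊠β⊞𝟙⊠𝟙 d-distance z z-small
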